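{- Let $\ell\geqslant 0$, $n\geqslant \ell+1$, $k\geqslant 2$, and $q\geqslant 1$ be integers. Then $$|\mathcal{F}_{n,\ell,k+1,\ell k+q}|=|\mathcal{E}_{n,\ell+1,k,q-1}|.$$
   Context: For $\ell\geqslant 0$, a finite set $A\subset\mathbb{N}$ is $\ell$-strong Schreier if $A=\emptyset$ or $\min A\geqslant \ell|A|-\ell+1$. A set $A=\{a_1<\cdots<a_n\}\subset\mathbb{N}$ is sparse if $|A|\leqslant 2$, or $|A|\geqslant 3$ and $a_i-a_{i-1}\geqslant a_{i-1}-a_{i-2}$ for $3\leqslant i\leqslant n$. $\mathcal{F}_{n,\ell}$ is the collection of sets of positive integers $A=\{a_1,\ldots,a_p,n+1\}$ such that (i) $p\geqslant 2$ and $a_1<\cdots<a_p<n+1$; (ii) $A$ is sparse and $\ell$-strong Schreier; (iii) $n+1+a_{p-1}=2a_p$. $\mathcal{F}_{n,\ell,k}$ consists of the sets in $\mathcal{F}_{n,\ell}$ with exactly $k$ elements, and $\mathcal{F}_{n,\ell,k,q}$ consists of the sets in $\mathcal{F}_{n,\ell,k}$ whose smallest element is $q$. $\mathcal{E}_{n,\ell}$ is the set of partitions of $n$ into parts each at least $\ell$; $\mathcal{E}_{n,\ell,k}$ consists of those with exactly $k$ parts; for $k\geqslant 2$ and $q\geqslant 0$, $\mathcal{E}_{n,\ell,k,q}$ consists of those partitions in $\mathcal{E}_{n,\ell,k}$ in which the largest part minus the second largest part equals $q$. -}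

module Defs where

open import Data.Nat using (ℕ; zero; suc; _+_; _*_; _∸_; _≤_; _<_; _≥_)
open import Data.List using (List; []; _∷_; length; head; last)
open import Data.Nat.ListAction using (sum)
open import Data.List.Relation.Unary.All using (All)
open import Data.List.Relation.Unary.Linked using (Linked)
open import Data.Maybe using (Maybe; just)
open import Data.Product using (_×_)
open import Data.Unit using (⊤)
open import Data.Empty using (⊥)
open import Relation.Binary.PropositionalEquality using (_≡_)

-- A finite set A ⊂ ℕ is represented by the strictly increasing list of its
-- elements (a₁ < a₂ < ⋯ < aₘ).

-- ℓ-strong Schreier: A = ∅ or min A ≥ ℓ|A| − ℓ + 1.
-- (ℓ|A| ≥ ℓ for nonempty A, so truncated subtraction is exact.)
StrongSchreier : ℕ → List ℕ → Set
StrongSchreier ℓ []       = ⊤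
StrongSchreier ℓ (a ∷ as) = ℓ * length (a ∷ as) ∸ ℓ + 1 ≤ a

-- Sparse: |A| ≤ 2, or a_i − a_{i−1} ≥ a_{i−1} − a_{i−2} for 3 ≤ i ≤ n.
-- (For an increasing list the truncated differences are the true ones.)
Sparse : List ℕ → Set
Sparse (x ∷ y ∷ z ∷ rest) = (y ∸ x ≤ z ∸ y) × Sparse (y ∷ z ∷ rest)
Sparse _                  = ⊤

-- Condition (iii): the last three elements a_{p-1}, a_p, n+1 satisfy
-- n + 1 + a_{p-1} = 2 a_p  (false if the list has fewer than 3 elements).
Cond3 : ℕ → List ℕ → Set
Cond3 n (x ∷ y ∷ z ∷ [])       = suc n + x ≡ 2 * y
Cond3 n (x ∷ y ∷ z ∷ w ∷ rest) = Cond3 n (y ∷ z ∷ w ∷ rest)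
Cond3 n _                      = ⊥

-- A ∈ 𝓕_{n,ℓ}: A = {a₁ < ⋯ < a_p < n+1} positive integers, p ≥ 2,
-- sparse, ℓ-strong Schreier, and n + 1 + a_{p−1} = 2 a_p.
record InF (n ℓ : ℕ) (A : List ℕ) : Set where
  field
    increasing : Linked _<_ A
    positive   : All (λ a → 1 ≤ a) A
    lastIsN+1  : last A ≡ just (suc n)
    p≥2        : 3 ≤ length A
    sparse     : Sparse A
    schreier   : StrongSchreier ℓ A
    cond3      : Cond3 n A

record InFkq (n ℓ k q : ℕ) (A : List ℕ) : Set where
  field
    inF     : InF n ℓ A
    size    : length A ≡ k
    minimum : head A ≡ just q

-- A partition of n is represented by the nonincreasing list of its parts.
-- Largest part minus second largest part (false if fewer than 2 parts).
TopGap : ℕ → List ℕ → Set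
TopGap q (x ∷ y ∷ _) = x ∸ y ≡ q
TopGap q _           = ⊥

record InE (n ℓ : ℕ) (P : List ℕ) : Set where
  field
    nonincreasing : Linked _≥_ P
    partsAtLeast  : All (λ x → ℓ ≤ x) P
    sumIsN        : sum P ≡ n

record InEkq (n ℓ k q : ℕ) (P : List ℕ) : Set where
  field
    inE   : InE n ℓ P
    parts : length P ≡ k
    gap   : TopGap q P

{-# OPTIONS --safe #-}
module Submission where

-- Write A = {a₁ < ⋯ < a_{k+1} = n + 1} with a₁ = ℓk + q through its gaps
-- dᵢ = a_{i+1} − aᵢ ≥ 1.  Sparseness says d₁ ≤ ⋯ ≤ d_k, condition (iii) says
-- d_{k−1} = d_k, the gaps sum to n + 1 − ℓk − q, and the Schreier condition
-- holds automatically for this minimum.  Reversing the gaps, adding ℓ to every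
-- part and q − 1 more to the first gives (d_k + ℓ + q − 1, d_{k−1} + ℓ, …, d₁ + ℓ),
-- a partition of n into k parts ≥ ℓ + 1 whose two largest parts differ by q − 1;
-- conversely every such partition arises from exactly one A.

open import Defs
open import Data.Nat using (ℕ; suc; _+_; _*_; _∸_; _≤_; _<_; _≥_; z≤n; s≤s)
open import Data.Nat.Properties
open import Data.Nat.ListAction using (sum)
open import Data.Nat.ListAction.Properties using (sum-↭)
open import Data.Nat.Solver using (module +-*-Solver)
open import Data.List using (List; []; _∷_; length; last; map; _++_; reverse; reverseAcc)
open import Data.List.Properties
  using (length-map; length-reverse; reverse-involutive; reverse-++; map-∘; map-cong; map-id; map-id-local)
open import Data.List.Scans.Base using (scanl)
open import Data.List.Relation.Unary.All as All using (All; []; _∷_)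
import Data.List.Relation.Unary.All.Properties as All
import Data.List.Relation.Unary.Linked.Properties as Linked
open import Data.List.Relation.Unary.Linked as Linked using (Linked; []; [-]; _∷_)
open import Data.List.Relation.Binary.Permutation.Propositional using (↭-sym)
open import Data.List.Relation.Binary.Permutation.Propositional.Properties using (↭-reverse; All-resp-↭)
open import Data.Maybe using (Maybe; just)
open import Data.Maybe.Properties using (just-injective)
import Data.Maybe.Properties as Maybe
open import Data.Product using (Σ; ∃₂; _,_)
open import Data.Unit using (tt)
open import Data.Empty using (⊥)
open import Function using (_∘_; flip)
open import Function.Bundles using (_↔_; mk↔ₛ′)
open import Relation.Binary.PropositionalEquality
open import Relation.Unary using (Irrelevant)
import Relation.Nullary as Nullary
open import Axiom.UniquenessOfIdentityProofs using (module Decidable⇒UIP)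

Σ-≡-irrelevant : {A : Set} {P : A → Set} → Irrelevant P →
  ∀ {x y} {p : P x} {q : P y} → x ≡ y → _≡_ {A = Σ A P} (x , p) (y , q)
Σ-≡-irrelevant irr refl = cong (_ ,_) (irr _ _)

↔-restrict : {A : Set} {P Q : A → Set} → Irrelevant P → Irrelevant Q →
  (f g : A → A) → (∀ {x} → P x → Q (f x)) → (∀ {y} → Q y → P (g y)) →
  (∀ {x} → P x → g (f x) ≡ x) → (∀ {y} → Q y → f (g y) ≡ y) →
  Σ A P ↔ Σ A Q
↔-restrict P-irr Q-irr f g f-resp g-resp g∘f f∘g =
  mk↔ₛ′ (λ (x , p) → f x , f-resp p) (λ (y , q) → g y , g-resp q)
        (λ (_ , q) → Σ-≡-irrelevant Q-irr (f∘g q))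
        (λ (_ , p) → Σ-≡-irrelevant P-irr (g∘f p))

Maybe-≡-irrelevant : {x y : Maybe ℕ} → Nullary.Irrelevant (x ≡ y)
Maybe-≡-irrelevant = Decidable⇒UIP.≡-irrelevant (Maybe.≡-dec _≟_)

Sparse-irrelevant : Irrelevant Sparse
Sparse-irrelevant {_ ∷ _ ∷ _ ∷ _} (p , s) (p′ , s′) =
  cong₂ _,_ (≤-irrelevant p p′) (Sparse-irrelevant s s′)
Sparse-irrelevant {[]}          _ _ = refl
Sparse-irrelevant {_ ∷ []}      _ _ = refl
Sparse-irrelevant {_ ∷ _ ∷ []}  _ _ = refl

StrongSchreier-irrelevant : ∀ ℓ → Irrelevant (StrongSchreier ℓ)
StrongSchreier-irrelevant ℓ {[]}    _ _ = refl
StrongSchreier-irrelevant ℓ {_ ∷ _} p q = ≤-irrelevant p q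

Cond3-irrelevant : ∀ n → Irrelevant (Cond3 n)
Cond3-irrelevant n {_ ∷ _ ∷ _ ∷ []}        p q = ≡-irrelevant p q
Cond3-irrelevant n {_ ∷ xs@(_ ∷ _ ∷ _ ∷ _)} p q = Cond3-irrelevant n {xs} p q

TopGap-irrelevant : ∀ q → Irrelevant (TopGap q)
TopGap-irrelevant q {_ ∷ _ ∷ _} p p′ = ≡-irrelevant p p′

InFkq-irrelevant : ∀ {n ℓ k q} → Irrelevant (InFkq n ℓ k q)
InFkq-irrelevant {n} {ℓ} {_} {_} {A}
  record { inF = record { increasing = a₁ ; positive = a₂ ; lastIsN+1 = a₃ ; p≥2 = a₄
                        ; sparse = a₅ ; schreier = a₆ ; cond3 = a₇ } ; size = a₈ ; minimum = a₉ }
  record { inF = record { increasing = b₁ ; positive = b₂ ; lastIsN+1 = b₃ ; p≥2 = b₄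
                        ; sparse = b₅ ; schreier = b₆ ; cond3 = b₇ } ; size = b₈ ; minimum = b₉ }
  with refl ← Linked.irrelevant <-irrelevant a₁ b₁
  with refl ← All.irrelevant ≤-irrelevant a₂ b₂
  with refl ← Maybe-≡-irrelevant a₃ b₃
  with refl ← ≤-irrelevant a₄ b₄
  with refl ← Sparse-irrelevant {A} a₅ b₅
  with refl ← StrongSchreier-irrelevant ℓ {A} a₆ b₆
  with refl ← Cond3-irrelevant n {A} a₇ b₇
  with refl ← ≡-irrelevant a₈ b₈
  with refl ← Maybe-≡-irrelevant a₉ b₉
  = refl

InEkq-irrelevant : ∀ {n ℓ k q} → Irrelevant (InEkq n ℓ k q)
InEkq-irrelevant {q = q} {P}
  record { inE = record { nonincreasing = a₁ ; partsAtLeast = a₂ ; sumIsN = a₃ } ; parts = a₄ ; gap = a₅ }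
  record { inE = record { nonincreasing = b₁ ; partsAtLeast = b₂ ; sumIsN = b₃ } ; parts = b₄ ; gap = b₅ }
  with refl ← Linked.irrelevant ≤-irrelevant a₁ b₁
  with refl ← All.irrelevant ≤-irrelevant a₂ b₂
  with refl ← ≡-irrelevant a₃ b₃
  with refl ← ≡-irrelevant a₄ b₄
  with refl ← TopGap-irrelevant q {P} a₅ b₅
  = refl

differences : List ℕ → List ℕ
differences (x ∷ y ∷ xs) = y ∸ x ∷ differences (y ∷ xs)
differences _            = []

differences-scanl : ∀ a D → differences (scanl _+_ a D) ≡ D
differences-scanl a []      = refl
differences-scanl a (d ∷ D) = cong₂ _∷_ (m+n∸m≡n a d) (differences-scanl (a + d) D)

scanl-differences : ∀ {a A} → Linked _<_ (a ∷ A) → scanl _+_ a (differences (a ∷ A)) ≡ a ∷ A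
scanl-differences {a} {[]}    _         = refl
scanl-differences {a} {b ∷ _} (a<b ∷ L) rewrite m+[n∸m]≡n (<⇒≤ a<b) =
  cong (a ∷_) (scanl-differences L)

differences-positive : ∀ {A} → Linked _<_ A → All (1 ≤_) (differences A)
differences-positive []        = []
differences-positive [-]       = []
differences-positive (a<b ∷ L) = m<n⇒0<n∸m a<b ∷ differences-positive L

scanl-increasing : ∀ a {D} → All (1 ≤_) D → Linked _<_ (scanl _+_ a D)
scanl-increasing a []       = [-]
scanl-increasing a (p ∷ ps) = m<m+n a p ∷ scanl-increasing _ ps

scanl-≥ : ∀ {b} a D → b ≤ a → All (b ≤_) (scanl _+_ a D)
scanl-≥ a []      b≤a = b≤a ∷ []
scanl-≥ a (d ∷ D) b≤a = b≤a ∷ scanl-≥ (a + d) D (≤-trans b≤a (m≤m+n a d))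

length-scanl : ∀ a D → length (scanl _+_ a D) ≡ suc (length D)
length-scanl a []      = refl
length-scanl a (d ∷ D) = cong suc (length-scanl (a + d) D)

last-scanl : ∀ a D → last (scanl _+_ a D) ≡ just (a + sum D)
last-scanl a []      = cong just (sym (+-identityʳ a))
last-scanl a (d ∷ D) = trans (last-scanl (a + d) D) (cong just (+-assoc a d (sum D)))

length-differences : ∀ a A → length (differences (a ∷ A)) ≡ length A
length-differences a []      = refl
length-differences a (b ∷ A) = cong suc (length-differences b A)

Sparse⇒differences-nondecreasing : ∀ A → Sparse A → Linked _≤_ (differences A)
Sparse⇒differences-nondecreasing (x ∷ y ∷ z ∷ A) (p , s) = p ∷ Sparse⇒differences-nondecreasing (y ∷ z ∷ A) s
Sparse⇒differences-nondecreasing []              _       = []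
Sparse⇒differences-nondecreasing (_ ∷ [])        _       = []
Sparse⇒differences-nondecreasing (_ ∷ _ ∷ [])    _       = [-]

differences-nondecreasing⇒Sparse : ∀ A → Linked _≤_ (differences A) → Sparse A
differences-nondecreasing⇒Sparse (x ∷ y ∷ z ∷ A) (p ∷ L) = p , differences-nondecreasing⇒Sparse (y ∷ z ∷ A) L
differences-nondecreasing⇒Sparse []              _       = tt
differences-nondecreasing⇒Sparse (_ ∷ [])        _       = tt
differences-nondecreasing⇒Sparse (_ ∷ _ ∷ [])    _       = tt

LastTwoEqual : List ℕ → Set
LastTwoEqual (x ∷ y ∷ [])    = x ≡ y
LastTwoEqual (_ ∷ y ∷ z ∷ D) = LastTwoEqual (y ∷ z ∷ D)
LastTwoEqual _               = ⊥

double-middle⇒equal-gaps : ∀ x y z → z + x ≡ 2 * y → y ∸ x ≡ z ∸ y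
double-middle⇒equal-gaps x y z z+x≡2y = sym (begin
  z ∸ y              ≡⟨ [m+n]∸[m+o]≡n∸o x z y ⟨
  (x + z) ∸ (x + y)  ≡⟨ cong₂ _∸_ x+z≡y+y (+-comm x y) ⟩
  (y + y) ∸ (y + x)  ≡⟨ [m+n]∸[m+o]≡n∸o y y x ⟩
  y ∸ x              ∎)
  where
  open ≡-Reasoning
  x+z≡y+y : x + z ≡ y + y
  x+z≡y+y = trans (+-comm x z) (trans z+x≡2y (cong (y +_) (+-identityʳ y)))

equal-gaps⇒double-middle : ∀ {x y z} → x ≤ y → y ≤ z → y ∸ x ≡ z ∸ y → z + x ≡ 2 * y
equal-gaps⇒double-middle {x} {y} {z} x≤y y≤z gaps≡ = begin
  z + x                  ≡⟨ cong (_+ x) (m∸n+n≡m y≤z) ⟨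
  (z ∸ y) + y + x        ≡⟨ cong (λ g → g + y + x) gaps≡ ⟨
  (y ∸ x) + y + x        ≡⟨ cong (_+ x) (+-comm (y ∸ x) y) ⟩
  y + (y ∸ x) + x        ≡⟨ +-assoc y (y ∸ x) x ⟩
  y + ((y ∸ x) + x)      ≡⟨ cong (y +_) (m∸n+n≡m x≤y) ⟩
  y + y                  ≡⟨ cong (y +_) (+-identityʳ y) ⟨
  2 * y                  ∎
  where open ≡-Reasoning

Cond3⇒LastTwoEqual : ∀ {n A} → Linked _<_ A → last A ≡ just (suc n) → Cond3 n A →
  LastTwoEqual (differences A)
Cond3⇒LastTwoEqual {A = x ∷ y ∷ z ∷ []}    _       refl c = double-middle⇒equal-gaps x y z c
Cond3⇒LastTwoEqual {A = _ ∷ _ ∷ _ ∷ _ ∷ _} (_ ∷ L) e    c = Cond3⇒LastTwoEqual L e c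

LastTwoEqual⇒Cond3 : ∀ {n A} → Linked _<_ A → last A ≡ just (suc n) →
  LastTwoEqual (differences A) → Cond3 n A
LastTwoEqual⇒Cond3 {A = _ ∷ _ ∷ _ ∷ []} (x<y ∷ y<z ∷ [-]) refl g =
  equal-gaps⇒double-middle (<⇒≤ x<y) (<⇒≤ y<z) g
LastTwoEqual⇒Cond3 {A = _ ∷ _ ∷ _ ∷ _ ∷ _} (_ ∷ L) e g = LastTwoEqual⇒Cond3 L e g

-- The gap sequences of the sets in 𝓕_{n,ℓ,k+1,a} when a > ℓk (then the Schreier condition is automatic).
record Gaps (n k a : ℕ) (D : List ℕ) : Set where
  field
    nondecreasing : Linked _≤_ D
    positive      : All (1 ≤_) D
    lastTwoEqual  : LastTwoEqual D
    length≡k      : length D ≡ k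
    a+sum≡1+n     : a + sum D ≡ suc n

F⇒Gaps : ∀ {n ℓ k a A} → InFkq n ℓ (suc k) a A → Gaps n k a (differences A)
F⇒Gaps {n} {A = a ∷ A} record { inF = F ; size = size ; minimum = refl } = record
  { nondecreasing = Sparse⇒differences-nondecreasing _ sparse
  ; positive      = differences-positive increasing
  ; lastTwoEqual  = Cond3⇒LastTwoEqual increasing lastIsN+1 cond3
  ; length≡k      = trans (length-differences a A) (suc-injective size)
  ; a+sum≡1+n     = just-injective (begin
      just (a + sum (differences (a ∷ A)))       ≡⟨ last-scanl a (differences (a ∷ A)) ⟨
      last (scanl _+_ a (differences (a ∷ A)))   ≡⟨ cong last (scanl-differences increasing) ⟩
      last (a ∷ A)                               ≡⟨ lastIsN+1 ⟩
      just (suc n)                               ∎)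
  }
  where open InF F; open ≡-Reasoning

StrongSchreier-bound : ∀ ℓ k c → ℓ * suc k ∸ ℓ + 1 ≤ ℓ * k + suc c
StrongSchreier-bound ℓ k c rewrite *-suc ℓ k | m+n∸m≡n ℓ (ℓ * k) = +-monoʳ-≤ (ℓ * k) (s≤s z≤n)

Gaps⇒F : ∀ {n ℓ k c D} → 2 ≤ k → Gaps n k (ℓ * k + suc c) D →
  InFkq n ℓ (suc k) (ℓ * k + suc c) (scanl _+_ (ℓ * k + suc c) D)
Gaps⇒F {n} {ℓ} {k} {c} {D} 2≤k G = record
  { inF = record
    { increasing = increasing
    ; positive   = scanl-≥ a D (≤-trans (s≤s z≤n) (m≤n+m (suc c) (ℓ * k)))
    ; lastIsN+1  = last≡1+n
    ; p≥2        = subst (3 ≤_) (sym length≡1+k) (s≤s 2≤k)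
    ; sparse     = differences-nondecreasing⇒Sparse _
                     (subst (Linked _≤_) (sym (differences-scanl a D)) nondecreasing)
    ; schreier   = subst (λ m → ℓ * m ∸ ℓ + 1 ≤ a) (sym length≡1+k) (StrongSchreier-bound ℓ k c)
    ; cond3      = LastTwoEqual⇒Cond3 increasing last≡1+n
                     (subst LastTwoEqual (sym (differences-scanl a D)) lastTwoEqual)
    }
  ; size    = length≡1+k
  ; minimum = refl
  }
  where
  open Gaps G
  a : ℕ
  a = ℓ * k + suc c
  increasing : Linked _<_ (scanl _+_ a D)
  increasing = scanl-increasing a positive
  last≡1+n : last (scanl _+_ a D) ≡ just (suc n)
  last≡1+n = trans (last-scanl a D) (cong just a+sum≡1+n)
  length≡1+k : length (scanl _+_ a D) ≡ suc k
  length≡1+k = trans (length-scanl a D) (cong suc length≡k)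

Linked-reverseAcc⁺ : {A : Set} {R : A → A → Set} {x : A} {acc xs : List A} →
  Linked (flip R) (x ∷ acc) → Linked R (x ∷ xs) → Linked (flip R) (reverseAcc (x ∷ acc) xs)
Linked-reverseAcc⁺ {xs = []}    Lacc _       = Lacc
Linked-reverseAcc⁺ {xs = _ ∷ _} Lacc (r ∷ L) = Linked-reverseAcc⁺ (r ∷ Lacc) L

Linked-reverse⁺ : {A : Set} {R : A → A → Set} {xs : List A} → Linked R xs → Linked (flip R) (reverse xs)
Linked-reverse⁺ {xs = []}    _ = []
Linked-reverse⁺ {xs = _ ∷ _} L = Linked-reverseAcc⁺ [-] L

All-reverse⁺ : {A : Set} {P : A → Set} {xs : List A} → All P xs → All P (reverse xs)
All-reverse⁺ {xs = xs} = All-resp-↭ (↭-sym (↭-reverse xs))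

FirstTwoEqual : List ℕ → Set
FirstTwoEqual (x ∷ y ∷ _) = x ≡ y
FirstTwoEqual _           = ⊥

LastTwoEqual⇒∃ : ∀ {D} → LastTwoEqual D → ∃₂ λ E d → D ≡ E ++ d ∷ d ∷ []
LastTwoEqual⇒∃ {x ∷ _ ∷ []} refl = [] , x , refl
LastTwoEqual⇒∃ {x ∷ D@(_ ∷ _ ∷ _)} e
  with E , d , D≡ ← LastTwoEqual⇒∃ {D} e = x ∷ E , d , cong (x ∷_) D≡

LastTwoEqual-∷ : ∀ x D → LastTwoEqual D → LastTwoEqual (x ∷ D)
LastTwoEqual-∷ x (_ ∷ _ ∷ _) e = e

LastTwoEqual-++ : ∀ E d → LastTwoEqual (E ++ d ∷ d ∷ [])
LastTwoEqual-++ []      d = refl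
LastTwoEqual-++ (x ∷ E) d = LastTwoEqual-∷ x (E ++ d ∷ d ∷ []) (LastTwoEqual-++ E d)

LastTwoEqual⇒FirstTwoEqual-reverse : ∀ D → LastTwoEqual D → FirstTwoEqual (reverse D)
LastTwoEqual⇒FirstTwoEqual-reverse D e
  with E , d , refl ← LastTwoEqual⇒∃ {D} e rewrite reverse-++ E (d ∷ d ∷ []) = refl

FirstTwoEqual⇒LastTwoEqual-reverse : ∀ R → FirstTwoEqual R → LastTwoEqual (reverse R)
FirstTwoEqual⇒LastTwoEqual-reverse (x ∷ _ ∷ R) refl
  rewrite reverse-++ (x ∷ x ∷ []) R = LastTwoEqual-++ (reverse R) x

record ReversedGaps (n k a : ℕ) (R : List ℕ) : Set where
  field
    nonincreasing : Linked _≥_ R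
    positive      : All (1 ≤_) R
    firstTwoEqual : FirstTwoEqual R
    length≡k      : length R ≡ k
    a+sum≡1+n     : a + sum R ≡ suc n

Gaps⇒ReversedGaps : ∀ {n k a D} → Gaps n k a D → ReversedGaps n k a (reverse D)
Gaps⇒ReversedGaps {a = a} {D} G = record
  { nonincreasing = Linked-reverse⁺ nondecreasing
  ; positive      = All-reverse⁺ positive
  ; firstTwoEqual = LastTwoEqual⇒FirstTwoEqual-reverse D lastTwoEqual
  ; length≡k      = trans (length-reverse D) length≡k
  ; a+sum≡1+n     = trans (cong (a +_) (sum-↭ (↭-reverse D))) a+sum≡1+n
  }
  where open Gaps G

ReversedGaps⇒Gaps : ∀ {n k a R} → ReversedGaps n k a R → Gaps n k a (reverse R)
ReversedGaps⇒Gaps {a = a} {R} G = record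
  { nondecreasing = Linked-reverse⁺ nonincreasing
  ; positive      = All-reverse⁺ positive
  ; lastTwoEqual  = FirstTwoEqual⇒LastTwoEqual-reverse R firstTwoEqual
  ; length≡k      = trans (length-reverse R) length≡k
  ; a+sum≡1+n     = trans (cong (a +_) (sum-↭ (↭-reverse R))) a+sum≡1+n
  }
  where open ReversedGaps G

raise : ℕ → ℕ → List ℕ → List ℕ
raise ℓ c []       = []
raise ℓ c (x ∷ xs) = ℓ + (x + c) ∷ map (ℓ +_) xs

lower : ℕ → ℕ → List ℕ → List ℕ
lower ℓ c []       = []
lower ℓ c (x ∷ xs) = x ∸ ℓ ∸ c ∷ map (_∸ ℓ) xs

lower-raise : ∀ ℓ c R → lower ℓ c (raise ℓ c R) ≡ R
lower-raise ℓ c []       = refl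
lower-raise ℓ c (x ∷ xs) = cong₂ _∷_ x+c∸c≡x
  (trans (sym (map-∘ xs)) (trans (map-cong (m+n∸m≡n ℓ) xs) (map-id xs)))
  where
  x+c∸c≡x : ℓ + (x + c) ∸ ℓ ∸ c ≡ x
  x+c∸c≡x = trans (cong (_∸ c) (m+n∸m≡n ℓ (x + c))) (m+n∸n≡m x c)

∸-∸-gap : ∀ ℓ {x y} → y ≤ x → x ∸ ℓ ∸ (x ∸ y) ≡ y ∸ ℓ
∸-∸-gap ℓ {x} {y} y≤x = begin
  x ∸ ℓ ∸ (x ∸ y)   ≡⟨ ∸-+-assoc x ℓ (x ∸ y) ⟩
  x ∸ (ℓ + (x ∸ y)) ≡⟨ cong (x ∸_) (+-comm ℓ (x ∸ y)) ⟩
  x ∸ ((x ∸ y) + ℓ) ≡⟨ ∸-+-assoc x (x ∸ y) ℓ ⟨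
  x ∸ (x ∸ y) ∸ ℓ   ≡⟨ cong (_∸ ℓ) (m∸[m∸n]≡n y≤x) ⟩
  y ∸ ℓ             ∎
  where open ≡-Reasoning

raise-lower : ∀ ℓ {x y} ys → y ≤ x → All (ℓ ≤_) (y ∷ ys) →
  raise ℓ (x ∸ y) (lower ℓ (x ∸ y) (x ∷ y ∷ ys)) ≡ x ∷ y ∷ ys
raise-lower ℓ {x} {y} ys y≤x ℓ≤ys = cong₂ _∷_ head≡x
  (trans (sym (map-∘ (y ∷ ys))) (map-id-local (All.map m+[n∸m]≡n ℓ≤ys)))
  where
  open ≡-Reasoning
  ℓ≤y : ℓ ≤ y
  ℓ≤y = All.head ℓ≤ys
  head≡x : ℓ + (x ∸ ℓ ∸ (x ∸ y) + (x ∸ y)) ≡ x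
  head≡x = begin
    ℓ + (x ∸ ℓ ∸ (x ∸ y) + (x ∸ y)) ≡⟨ cong (λ z → ℓ + (z + (x ∸ y))) (∸-∸-gap ℓ y≤x) ⟩
    ℓ + ((y ∸ ℓ) + (x ∸ y))         ≡⟨ +-assoc ℓ (y ∸ ℓ) (x ∸ y) ⟨
    ℓ + (y ∸ ℓ) + (x ∸ y)           ≡⟨ cong (_+ (x ∸ y)) (m+[n∸m]≡n ℓ≤y) ⟩
    y + (x ∸ y)                     ≡⟨ m+[n∸m]≡n y≤x ⟩
    x                               ∎

sum-map-+ : ∀ ℓ xs → sum (map (ℓ +_) xs) ≡ ℓ * length xs + sum xs
sum-map-+ ℓ []       = cong (_+ 0) (sym (*-zeroʳ ℓ))
sum-map-+ ℓ (x ∷ xs) rewrite sum-map-+ ℓ xs | *-suc ℓ (length xs) =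
  solve 4 (λ ℓ x m s → ℓ :+ x :+ (m :+ s) := ℓ :+ m :+ (x :+ s)) refl ℓ x (ℓ * length xs) (sum xs)
  where open +-*-Solver

suc-sum-raise : ∀ ℓ c x xs → suc (sum (raise ℓ c (x ∷ xs))) ≡ ℓ * length (x ∷ xs) + suc c + sum (x ∷ xs)
suc-sum-raise ℓ c x xs rewrite sum-map-+ ℓ xs | *-suc ℓ (length xs) =
  solve 5 (λ ℓ x c m s → con 1 :+ (ℓ :+ (x :+ c) :+ (m :+ s)) := ℓ :+ m :+ (con 1 :+ c) :+ (x :+ s))
    refl ℓ x c (ℓ * length xs) (sum xs)
  where open +-*-Solver

ℓ+1≤⇒ℓ< : ∀ {ℓ y} → ℓ + 1 ≤ y → ℓ < y
ℓ+1≤⇒ℓ< {ℓ} {y} = subst (_≤ y) (+-comm ℓ 1)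

ReversedGaps⇒E : ∀ {n ℓ k c R} → ReversedGaps n k (ℓ * k + suc c) R → InEkq n (ℓ + 1) k c (raise ℓ c R)
ReversedGaps⇒E {n} {ℓ} {k} {c} {x ∷ _ ∷ xs}
  record { nonincreasing = _ ∷ L ; positive = 1≤x ∷ ps ; firstTwoEqual = refl
         ; length≡k = length≡k ; a+sum≡1+n = a+sum≡1+n } = record
  { inE = record
    { nonincreasing = +-monoʳ-≤ ℓ (m≤m+n x c) ∷ Linked.map⁺ (Linked.map (+-monoʳ-≤ ℓ) L)
    ; partsAtLeast  = +-monoʳ-≤ ℓ (≤-trans 1≤x (m≤m+n x c)) ∷ All.map⁺ (All.map (+-monoʳ-≤ ℓ) ps)
    ; sumIsN        = suc-injective (begin
        suc (sum (raise ℓ c (x ∷ x ∷ xs)))                 ≡⟨ suc-sum-raise ℓ c x (x ∷ xs) ⟩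
        ℓ * length (x ∷ x ∷ xs) + suc c + sum (x ∷ x ∷ xs) ≡⟨ cong (λ m → ℓ * m + suc c + _) length≡k ⟩
        ℓ * k + suc c + sum (x ∷ x ∷ xs)                   ≡⟨ a+sum≡1+n ⟩
        suc n                                              ∎)
    }
  ; parts = trans (cong suc (length-map (ℓ +_) (x ∷ xs))) length≡k
  ; gap   = trans ([m+n]∸[m+o]≡n∸o ℓ (x + c) x) (m+n∸m≡n x c)
  }
  where open ≡-Reasoning

E⇒ReversedGaps : ∀ {n ℓ k c P} → InEkq n (ℓ + 1) k c P → ReversedGaps n k (ℓ * k + suc c) (lower ℓ c P)
E⇒ReversedGaps {n} {ℓ} {k} {P = x ∷ y ∷ ys}
  record { inE = record { nonincreasing = y≤x ∷ L ; partsAtLeast = _ ∷ ℓ<ys ; sumIsN = sum≡n }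
         ; parts = parts ; gap = refl } = record
  { nonincreasing = ≤-reflexive (sym head≡) ∷ Linked.map⁺ (Linked.map (∸-monoˡ-≤ ℓ) L)
  ; positive      = subst (1 ≤_) (sym head≡) (All.head 1≤tail) ∷ 1≤tail
  ; firstTwoEqual = head≡
  ; length≡k      = length≡k
  ; a+sum≡1+n     = begin
      ℓ * k + suc c + sum R         ≡⟨ cong (λ m → ℓ * m + suc c + sum R) length≡k ⟨
      ℓ * length R + suc c + sum R  ≡⟨ suc-sum-raise ℓ c _ (map (_∸ ℓ) (y ∷ ys)) ⟨
      suc (sum (raise ℓ c R))       ≡⟨ cong (suc ∘ sum) (raise-lower ℓ ys y≤x ℓ≤ys) ⟩
      suc (sum (x ∷ y ∷ ys))        ≡⟨ cong suc sum≡n ⟩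
      suc n                         ∎
  }
  where
  open ≡-Reasoning
  c : ℕ
  c = x ∸ y
  R : List ℕ
  R = lower ℓ c (x ∷ y ∷ ys)
  head≡ : x ∸ ℓ ∸ c ≡ y ∸ ℓ
  head≡ = ∸-∸-gap ℓ y≤x
  ℓ≤ys : All (ℓ ≤_) (y ∷ ys)
  ℓ≤ys = All.map (<⇒≤ ∘ ℓ+1≤⇒ℓ<) ℓ<ys
  1≤tail : All (1 ≤_) (map (_∸ ℓ) (y ∷ ys))
  1≤tail = All.map⁺ (All.map (m<n⇒0<n∸m ∘ ℓ+1≤⇒ℓ<) ℓ<ys)
  length≡k : length R ≡ k
  length≡k = trans (cong suc (length-map (_∸ ℓ) (y ∷ ys))) parts

toPartition : ℕ → ℕ → List ℕ → List ℕ
toPartition ℓ c = raise ℓ c ∘ reverse ∘ differences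

fromPartition : ℕ → ℕ → ℕ → List ℕ → List ℕ
fromPartition a ℓ c = scanl _+_ a ∘ reverse ∘ lower ℓ c

fromPartition-toPartition : ∀ {n ℓ k a c A} → InFkq n ℓ (suc k) a A →
  fromPartition a ℓ c (toPartition ℓ c A) ≡ A
fromPartition-toPartition {ℓ = ℓ} {a = a} {c} {A = _ ∷ A} record { inF = F ; minimum = refl } = begin
  scanl _+_ a (reverse (lower ℓ c (raise ℓ c (reverse D))))
    ≡⟨ cong (scanl _+_ a ∘ reverse) (lower-raise ℓ c (reverse D)) ⟩
  scanl _+_ a (reverse (reverse D))  ≡⟨ cong (scanl _+_ a) (reverse-involutive D) ⟩
  scanl _+_ a D                      ≡⟨ scanl-differences (InF.increasing F) ⟩
  a ∷ A                              ∎
  where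
  open ≡-Reasoning
  D : List ℕ
  D = differences (a ∷ A)

toPartition-fromPartition : ∀ {n ℓ k a c P} → InEkq n (ℓ + 1) k c P →
  toPartition ℓ c (fromPartition a ℓ c P) ≡ P
toPartition-fromPartition {ℓ = ℓ} {a = a} {P = x ∷ y ∷ ys}
  record { inE = record { nonincreasing = y≤x ∷ _ ; partsAtLeast = _ ∷ ℓ<ys } ; gap = refl } = begin
  raise ℓ c (reverse (differences (scanl _+_ a (reverse R))))
    ≡⟨ cong (raise ℓ c ∘ reverse) (differences-scanl a (reverse R)) ⟩
  raise ℓ c (reverse (reverse R))  ≡⟨ cong (raise ℓ c) (reverse-involutive R) ⟩
  raise ℓ c R                      ≡⟨ raise-lower ℓ ys y≤x (All.map (<⇒≤ ∘ ℓ+1≤⇒ℓ<) ℓ<ys) ⟩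
  x ∷ y ∷ ys                       ∎
  where
  open ≡-Reasoning
  c : ℕ
  c = x ∸ y
  R : List ℕ
  R = lower ℓ c (x ∷ y ∷ ys)

lemma2p2 : (ℓ n k q : ℕ) → ℓ + 1 ≤ n → 2 ≤ k → 1 ≤ q →
    Σ (List ℕ) (InFkq n ℓ (suc k) (ℓ * k + q)) ↔ Σ (List ℕ) (InEkq n (ℓ + 1) k (q ∸ 1))
lemma2p2 ℓ n k (suc c) _ 2≤k _ =
  ↔-restrict InFkq-irrelevant InEkq-irrelevant
    (toPartition ℓ c) (fromPartition (ℓ * k + suc c) ℓ c)
    (ReversedGaps⇒E ∘ Gaps⇒ReversedGaps ∘ F⇒Gaps)
    (Gaps⇒F 2≤k ∘ ReversedGaps⇒Gaps ∘ E⇒ReversedGaps)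
    fromPartition-toPartition
    toPartition-fromPartition
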